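{- Let $M$ be a positive integer and let $a$ and $r$ be nonnegative integers. Put $A_M:=\operatorname{lcm}(1,2,\dots,M)$. Then $$\sum_{N=0}^{\infty} p\bigl(MN-(A_M a+r),\,2M,\,N\bigr)z^{N}=\frac{\mathrm{Num}_e(M,r)}{(1-z^2)\,(z;z)_{2M-1}},$$ where $$\mathrm{Num}_e(M,r)=\sum_{j=1}^M(-1)^{M-j}\,z^{A_M a/j}\, S_j\!\left(z^{\,r+\binom{M-j+1}{2}}\,\frac{(1-z^{2j})\,(z^j;z^j)_{2M-1}}{(z;z)_{2M}}\begin{bmatrix}2M\\ M-j\end{bmatrix}_z\right).$$
   Context: For an indeterminate $x$ and a nonnegative integer $k$, $(x;q)_k:=(1-x)(1-xq)\cdots(1-xq^{k-1})$ with $(x;q)_0:=1$. The Gaussian polynomial ($q$-binomial coefficient) is $\begin{bmatrix}N+m\\ m\end{bmatrix}_q=\frac{(q;q)_{N+m}}{(q;q)_m(q;q)_N}$ for $m,N\ge 0$. For integers $n$ and $m,N\ge0$, $p(n,m,N)$ denotes the number of partitions of $n$ into at most $m$ parts, each part at most $N$; equivalently $p(n,m,N)$ is the coefficient of $q^n$ in $\begin{bmatrix}N+m\\ m\end{bmatrix}_q$ (so it is $0$ for $n<0$ or $n>mN$). For a polynomial $P(z)=\sum_{i=0}^d a_i z^i$ and a positive integer $s$, the $s$-dissection is $(S_sP)(z):=\sum_{i=0}^{\lfloor d/s\rfloor} a_{is}z^i$ (the expression inside $S_j$ above is a polynomial in $z$). -}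

module Defs where

open import Data.Nat as ℕ using (ℕ; zero; suc; _+_; _*_; _∸_; _≤?_; _≟_)
open import Data.Nat.DivMod using (_/_)
open import Data.Nat.LCM using (lcm)
open import Data.Nat.Divisibility using (_∣?_)
open import Data.Nat.Combinatorics using (_C_)
open import Data.Nat.ListAction using (sum)
open import Data.Integer as ℤ using (ℤ; +_; -[1+_])
open import Data.List as List using (List; []; _∷_; upTo; filter; length; concatMap)
open import Relation.Nullary.Decidable using (⌊_⌋)
open import Data.Bool using (if_then_else_)

-- A partition into at most m parts each ≤ N is
-- encoded as a nonincreasing list of length m with entries in 0..N
-- (padding with zeros).

nonincr : ℕ → ℕ → List (List ℕ)
nonincr zero    b = [] ∷ []
nonincr (suc m) b = concatMap (λ k → List.map (k ∷_) (nonincr m k)) (upTo (suc b))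

p : ℕ → ℕ → ℕ → ℕ
p n m N = length (filter (λ l → sum l ≟ n) (nonincr m N))

pℤ : ℤ → ℕ → ℕ → ℕ
pℤ (+ n)    m N = p n m N
pℤ -[1+ _ ] m N = 0

-- Formal power series in z with integer coefficients: n ↦ [z^n] F.

PS : Set
PS = ℕ → ℤ

Σ< : ℕ → (ℕ → ℤ) → ℤ
Σ< zero    f = + 0
Σ< (suc n) f = Σ< n f ℤ.+ f n

_⊛_ : PS → PS → PS
(f ⊛ g) n = Σ< (suc n) (λ k → f k ℤ.* g (n ∸ k))
infixl 7 _⊛_

_⊕_ : PS → PS → PS
(f ⊕ g) n = f n ℤ.+ g n
infixl 6 _⊕_

_·_ : ℤ → PS → PS
(c · f) n = c ℤ.* f n
infixr 7 _·_

zeroPS : PS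
zeroPS _ = + 0

zpow : ℕ → PS
zpow e n = if ⌊ n ≟ e ⌋ then + 1 else + 0

onePS : PS
onePS = zpow 0

oneMinus : ℕ → PS
oneMinus e = onePS ⊕ (ℤ.-[1+ 0 ] · zpow e)

Π< : ℕ → (ℕ → PS) → PS
Π< zero    F = onePS
Π< (suc n) F = Π< n F ⊛ F n

ΣPS< : ℕ → (ℕ → PS) → PS
ΣPS< zero    F = zeroPS
ΣPS< (suc n) F = ΣPS< n F ⊕ F n

-- (z^a ; z^b)_n = Π_{i<n} (1 - z^{a + b i})
qpoch : ℕ → ℕ → ℕ → PS
qpoch a b n = Π< n (λ i → oneMinus (a + b * i))

-- 1/(1 - z^(suc i)) = Σ_k z^{(suc i) k}
geomInv : ℕ → PS
geomInv i n = if ⌊ suc i ∣? n ⌋ then + 1 else + 0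

invPoch : ℕ → PS
invPoch n = Π< n geomInv

-- Gaussian polynomial [N+m, m]_z = (z;z)_{N+m} / ((z;z)_m (z;z)_N)
gauss : ℕ → ℕ → PS
gauss N m = qpoch 1 1 (N + m) ⊛ invPoch m ⊛ invPoch N

shift : ℕ → PS → PS
shift e f n = if ⌊ e ≤? n ⌋ then f (n ∸ e) else + 0

-- s-dissection: (S_s F)(z) = Σ_i [z^{is}]F z^i
dissect : ℕ → PS → PS
dissect s f n = f (s * n)

A : ℕ → ℕ
A M = List.foldr lcm 1 (List.map suc (upTo M))

-- the j-th summand of Num_e(M,r), with j = suc k (so 1 ≤ j)
numTerm : ℕ → ℕ → ℕ → ℕ → PS
numTerm M a r k =
  (ℤ.-[1+ 0 ] ℤ.^ (M ∸ j)) ·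
    shift ((A M * a) / j)
      (dissect j
        (shift (r + ((M ∸ j + 1) C 2))
          (oneMinus (2 * j) ⊛ qpoch j j (2 * M ∸ 1)
             ⊛ invPoch (2 * M) ⊛ gauss (M + j) (M ∸ j))))
  where j = suc k

Num : ℕ → ℕ → ℕ → PS
Num M a r = ΣPS< M (numTerm M a r)

lhs : ℕ → ℕ → ℕ → PS
lhs M a r N = + pℤ ((+ (M * N)) ℤ.- (+ (A M * a + r))) (2 * M) N

rhs : ℕ → ℕ → ℕ → PS
rhs M a r = Num M a r ⊛ geomInv 1 ⊛ invPoch (2 * M ∸ 1)

-- The partition counts p(n, m, N) have the Gaussian polynomial [N + m, m]_z as generating
-- function in n (both satisfy the q-Pascal recurrence), and Cauchy's q-binomial theorem expands
--   [N + m, m]_z = Σ_{i ≤ m} (-1)^i z^(C(i+1,2) + N i) / ((z;z)_i (z;z)_(m-i)).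
-- Take m = 2M and read off the coefficient of z^(MN - A_M a - r). For i ≥ M the exponent
-- C(i+1,2) + N i already exceeds MN, so only i = M - j with 1 ≤ j ≤ M contributes, namely the
-- coefficient of z^(jN) in (-1)^(M-j) z^(A_M a + r + C(M-j+1,2)) / ((z;z)_(M-j) (z;z)_(M+j)); as a
-- function of N this is a j-dissection. Since j divides A_M, z^(A_M a / j) S_j F = S_j (z^(A_M a) F),
-- and S_j turns the factor (1 - z^(2j)) (z^j;z^j)_(2M-1) of the j-th summand of Num_e into
-- (1 - z^2) (z;z)_(2M-1), which cancels against the denominator.

module Submission where

open import Defs
open import Algebra.Bundles using (CommutativeMonoid)
open import Data.Empty using (⊥-elim)
open import Data.Integer as ℤ using (ℤ; +_; -[1+_]) renaming (_+_ to _+ᶻ_; _*_ to _*ᶻ_; _-_ to _-ᶻ_)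
import Data.Integer.Properties as ℤ
import Data.Integer.Tactic.RingSolver as ℤ-Solver
open import Data.List as List using (List; []; _∷_; _++_; _∷ʳ_; length; filter; concatMap; upTo)
open import Data.List.Membership.Propositional using (_∈_)
open import Data.List.Membership.Propositional.Properties using (∈-map⁺; ∈-upTo⁺)
open import Data.List.Properties using (filter-++; filter-accept; filter-reject; length-++; ++-identityʳ; upTo-∷ʳ; concatMap-++)
open import Data.List.Relation.Unary.Any using (here; there)
open import Data.Nat as ℕ using (ℕ; zero; suc; _+_; _*_; _∸_; _≤_; _<_; z≤n; s≤s; _≤?_; NonZero)
open import Data.Nat.Combinatorics using (_C_; nC1≡n; nCk+nC[k+1]≡[n+1]C[k+1])
open import Data.Nat.Divisibility using (_∣_; _∣?_; ∣⇒≤; ∣m+n∣m⇒∣n; ∣m∸n∣n⇒∣m; ∣-refl; ∣-trans; m∣m*n)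
open import Data.Nat.DivMod using (_/_; m*[n/m]≡n)
open import Data.Nat.LCM using (lcm; m∣lcm[m,n]; n∣lcm[m,n])
open import Data.Nat.ListAction using (sum)
import Data.Nat.Properties as ℕ
import Data.Nat.Tactic.RingSolver as ℕ-Solver
open import Data.Product using (_,_)
open import Function using (_∘_)
open import Relation.Binary.Bundles using (Setoid)
open import Relation.Binary.PropositionalEquality hiding (J)
import Relation.Binary.Reasoning.Setoid as SetoidReasoningOn
open import Relation.Binary.Structures using (IsEquivalence)
open import Relation.Nullary using (Dec; yes; no; ¬_)

Σ<-cong : ∀ n {f g : ℕ → ℤ} → (∀ k → k < n → f k ≡ g k) → Σ< n f ≡ Σ< n g
Σ<-cong zero    f≡g = refl
Σ<-cong (suc n) f≡g = cong₂ _+ᶻ_ (Σ<-cong n (λ k k<n → f≡g k (ℕ.m<n⇒m<1+n k<n))) (f≡g n (ℕ.n<1+n n))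

Σ<-zero : ∀ n {f : ℕ → ℤ} → (∀ k → k < n → f k ≡ + 0) → Σ< n f ≡ + 0
Σ<-zero zero    f≡0 = refl
Σ<-zero (suc n) f≡0 = cong₂ _+ᶻ_ (Σ<-zero n (λ k k<n → f≡0 k (ℕ.m<n⇒m<1+n k<n))) (f≡0 n (ℕ.n<1+n n))

Σ<-distrib-+ : ∀ n (f g : ℕ → ℤ) → Σ< n (λ k → f k +ᶻ g k) ≡ Σ< n f +ᶻ Σ< n g
Σ<-distrib-+ zero    f g = refl
Σ<-distrib-+ (suc n) f g =
  trans (cong (_+ᶻ (f n +ᶻ g n)) (Σ<-distrib-+ n f g)) (interchange (Σ< n f) (Σ< n g) (f n) (g n))
  where
  interchange : ∀ a b c d → (a +ᶻ b) +ᶻ (c +ᶻ d) ≡ (a +ᶻ c) +ᶻ (b +ᶻ d)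
  interchange = ℤ-Solver.solve-∀

*-distribˡ-Σ< : ∀ n c (f : ℕ → ℤ) → c *ᶻ Σ< n f ≡ Σ< n (λ k → c *ᶻ f k)
*-distribˡ-Σ< zero    c f = ℤ.*-zeroʳ c
*-distribˡ-Σ< (suc n) c f = trans (ℤ.*-distribˡ-+ c (Σ< n f) (f n)) (cong (_+ᶻ c *ᶻ f n) (*-distribˡ-Σ< n c f))

*-distribʳ-Σ< : ∀ n c (f : ℕ → ℤ) → Σ< n f *ᶻ c ≡ Σ< n (λ k → f k *ᶻ c)
*-distribʳ-Σ< n c f =
  trans (ℤ.*-comm (Σ< n f) c) (trans (*-distribˡ-Σ< n c f) (Σ<-cong n (λ k _ → ℤ.*-comm c (f k))))

Σ<-sucˡ : ∀ n (f : ℕ → ℤ) → Σ< (suc n) f ≡ f 0 +ᶻ Σ< n (λ k → f (suc k))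
Σ<-sucˡ zero    f = trans (ℤ.+-identityˡ (f 0)) (sym (ℤ.+-identityʳ (f 0)))
Σ<-sucˡ (suc n) f = trans (cong (_+ᶻ f (suc n)) (Σ<-sucˡ n f)) (ℤ.+-assoc (f 0) _ _)

Σ<-split : ∀ m n (f : ℕ → ℤ) → Σ< (m + n) f ≡ Σ< m f +ᶻ Σ< n (λ k → f (m + k))
Σ<-split m zero    f = trans (cong (λ l → Σ< l f) (ℕ.+-identityʳ m)) (sym (ℤ.+-identityʳ _))
Σ<-split m (suc n) f = begin
  Σ< (m + suc n) f                                     ≡⟨ cong (λ l → Σ< l f) (ℕ.+-suc m n) ⟩
  Σ< (m + n) f +ᶻ f (m + n)                            ≡⟨ cong (_+ᶻ f (m + n)) (Σ<-split m n f) ⟩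
  (Σ< m f +ᶻ Σ< n (λ k → f (m + k))) +ᶻ f (m + n)      ≡⟨ ℤ.+-assoc (Σ< m f) _ _ ⟩
  Σ< m f +ᶻ Σ< (suc n) (λ k → f (m + k))               ∎
  where open ≡-Reasoning

Σ<-reverse : ∀ n (f : ℕ → ℤ) → Σ< n f ≡ Σ< n (λ k → f (n ∸ suc k))
Σ<-reverse zero    f = refl
Σ<-reverse (suc n) f = begin
  Σ< n f +ᶻ f n                          ≡⟨ ℤ.+-comm (Σ< n f) (f n) ⟩
  f n +ᶻ Σ< n f                          ≡⟨ cong (f n +ᶻ_) (Σ<-reverse n f) ⟩
  f n +ᶻ Σ< n (λ k → f (n ∸ suc k))      ≡⟨ Σ<-sucˡ n (λ k → f (n ∸ k)) ⟨
  Σ< (suc n) (λ k → f (n ∸ k))           ∎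
  where open ≡-Reasoning

Σ<-single : ∀ n e (f : ℕ → ℤ) → e < n → (∀ k → k < n → k ≢ e → f k ≡ + 0) → Σ< n f ≡ f e
Σ<-single (suc n) e f e<1+n f≡0 with e ℕ.≟ n
... | yes refl = trans (cong (_+ᶻ f e) (Σ<-zero n (λ k k<n → f≡0 k (ℕ.m<n⇒m<1+n k<n) (ℕ.<⇒≢ k<n))))
                       (ℤ.+-identityˡ _)
... | no e≢n   = trans (cong₂ _+ᶻ_ (Σ<-single n e f (ℕ.≤∧≢⇒< (ℕ.≤-pred e<1+n) e≢n)
                                                  (λ k k<n → f≡0 k (ℕ.m<n⇒m<1+n k<n)))
                                   (f≡0 n (ℕ.n<1+n n) (e≢n ∘ sym)))
                       (ℤ.+-identityʳ _)

Σ<-triangle : ∀ n (F : ℕ → ℕ → ℤ) →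
  Σ< n (λ k → Σ< (suc k) (λ l → F l k)) ≡ Σ< n (λ l → Σ< (n ∸ l) (λ m → F l (l + m)))
Σ<-triangle zero    F = refl
Σ<-triangle (suc n) F = begin
  Σ< n (λ k → Σ< (suc k) (λ l → F l k)) +ᶻ (Σ< n (λ l → F l n) +ᶻ F n n)
    ≡⟨ cong (_+ᶻ (Σ< n (λ l → F l n) +ᶻ F n n)) (Σ<-triangle n F) ⟩
  Σ< n rows +ᶻ (Σ< n (λ l → F l n) +ᶻ F n n)
    ≡⟨ ℤ.+-assoc (Σ< n rows) _ _ ⟨
  (Σ< n rows +ᶻ Σ< n (λ l → F l n)) +ᶻ F n n
    ≡⟨ cong₂ _+ᶻ_ (Σ<-distrib-+ n rows (λ l → F l n)) lastRow ⟨
  Σ< n (λ l → rows l +ᶻ F l n) +ᶻ Σ< (suc n ∸ n) (λ m → F n (n + m))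
    ≡⟨ cong (_+ᶻ Σ< (suc n ∸ n) (λ m → F n (n + m))) (Σ<-cong n extendRow) ⟩
  Σ< n (λ l → Σ< (suc n ∸ l) (λ m → F l (l + m))) +ᶻ Σ< (suc n ∸ n) (λ m → F n (n + m))
    ∎
  where
  open ≡-Reasoning
  rows : ℕ → ℤ
  rows l = Σ< (n ∸ l) (λ m → F l (l + m))
  lastRow : Σ< (suc n ∸ n) (λ m → F n (n + m)) ≡ F n n
  lastRow rewrite ℕ.m+n∸n≡m 1 n | ℕ.+-identityʳ n = ℤ.+-identityˡ _
  extendRow : ∀ l → l < n → rows l +ᶻ F l n ≡ Σ< (suc n ∸ l) (λ m → F l (l + m))
  extendRow l l<n rewrite ℕ.+-∸-assoc 1 (ℕ.<⇒≤ l<n) =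
    cong (rows l +ᶻ_) (cong (F l) (sym (ℕ.m+[n∸m]≡n (ℕ.<⇒≤ l<n))))

infix 4 _≈_
_≈_ : PS → PS → Set
f ≈ g = ∀ n → f n ≡ g n

≈-isEquivalence : IsEquivalence _≈_
≈-isEquivalence = record
  { refl  = λ _ → refl
  ; sym   = λ f≈g n → sym (f≈g n)
  ; trans = λ f≈g g≈h n → trans (f≈g n) (g≈h n)
  }

≈-setoid : Setoid _ _
≈-setoid = record { isEquivalence = ≈-isEquivalence }

open IsEquivalence ≈-isEquivalence
  using () renaming (refl to ≈-refl; sym to ≈-sym; trans to ≈-trans)

module SetoidReasoning = SetoidReasoningOn ≈-setoid

≡⇒≈ : ∀ {f g} → f ≡ g → f ≈ g
≡⇒≈ refl = ≈-refl

⊛-cong : ∀ {f f′ g g′} → f ≈ f′ → g ≈ g′ → f ⊛ g ≈ f′ ⊛ g′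
⊛-cong f≈f′ g≈g′ n = Σ<-cong (suc n) (λ k _ → cong₂ _*ᶻ_ (f≈f′ k) (g≈g′ (n ∸ k)))

⊛-congˡ : ∀ {f f′} g → f ≈ f′ → f ⊛ g ≈ f′ ⊛ g
⊛-congˡ g f≈f′ = ⊛-cong f≈f′ (≈-refl {g})

⊛-congʳ : ∀ f {g g′} → g ≈ g′ → f ⊛ g ≈ f ⊛ g′
⊛-congʳ f g≈g′ = ⊛-cong (≈-refl {f}) g≈g′

⊕-cong : ∀ {f f′ g g′} → f ≈ f′ → g ≈ g′ → f ⊕ g ≈ f′ ⊕ g′
⊕-cong f≈f′ g≈g′ n = cong₂ _+ᶻ_ (f≈f′ n) (g≈g′ n)

·-cong : ∀ c {f f′} → f ≈ f′ → c · f ≈ c · f′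
·-cong c f≈f′ n = cong (c *ᶻ_) (f≈f′ n)

⊛-comm : ∀ f g → f ⊛ g ≈ g ⊛ f
⊛-comm f g n = trans (Σ<-reverse (suc n) (λ k → f k *ᶻ g (n ∸ k))) (Σ<-cong (suc n) swap)
  where
  swap : ∀ k → k < suc n → f (n ∸ k) *ᶻ g (n ∸ (n ∸ k)) ≡ g k *ᶻ f (n ∸ k)
  swap k k<1+n rewrite ℕ.m∸[m∸n]≡n (ℕ.≤-pred k<1+n) = ℤ.*-comm (f (n ∸ k)) (g k)

⊛-assoc : ∀ f g h → (f ⊛ g) ⊛ h ≈ f ⊛ (g ⊛ h)
⊛-assoc f g h n = begin
  Σ< (suc n) (λ k → Σ< (suc k) (λ l → f l *ᶻ g (k ∸ l)) *ᶻ h (n ∸ k))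
    ≡⟨ Σ<-cong (suc n) (λ k _ → *-distribʳ-Σ< (suc k) (h (n ∸ k)) _) ⟩
  Σ< (suc n) (λ k → Σ< (suc k) (λ l → f l *ᶻ g (k ∸ l) *ᶻ h (n ∸ k)))
    ≡⟨ Σ<-triangle (suc n) (λ l k → f l *ᶻ g (k ∸ l) *ᶻ h (n ∸ k)) ⟩
  Σ< (suc n) (λ l → Σ< (suc n ∸ l) (λ m → f l *ᶻ g (l + m ∸ l) *ᶻ h (n ∸ (l + m))))
    ≡⟨ Σ<-cong (suc n) (λ l l<1+n → factorOut l (ℕ.≤-pred l<1+n)) ⟩
  Σ< (suc n) (λ l → f l *ᶻ Σ< (suc (n ∸ l)) (λ m → g m *ᶻ h (n ∸ l ∸ m)))
    ∎
  where
  open ≡-Reasoning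
  factorOut : ∀ l → l ≤ n → Σ< (suc n ∸ l) (λ m → f l *ᶻ g (l + m ∸ l) *ᶻ h (n ∸ (l + m)))
                          ≡ f l *ᶻ Σ< (suc (n ∸ l)) (λ m → g m *ᶻ h (n ∸ l ∸ m))
  factorOut l l≤n rewrite ℕ.+-∸-assoc 1 l≤n = trans
    (Σ<-cong (suc (n ∸ l)) (λ m _ → trans
      (cong₂ (λ x y → f l *ᶻ g x *ᶻ h y) (ℕ.m+n∸m≡n l m) (sym (ℕ.∸-+-assoc n l m)))
      (ℤ.*-assoc (f l) (g m) (h (n ∸ l ∸ m)))))
    (sym (*-distribˡ-Σ< (suc (n ∸ l)) (f l) _))

⊛-distribˡ-⊕ : ∀ f g h → f ⊛ (g ⊕ h) ≈ (f ⊛ g) ⊕ (f ⊛ h)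
⊛-distribˡ-⊕ f g h n =
  trans (Σ<-cong (suc n) (λ k _ → ℤ.*-distribˡ-+ (f k) (g (n ∸ k)) (h (n ∸ k)))) (Σ<-distrib-+ (suc n) _ _)

⊛-distribʳ-⊕ : ∀ f g h → (g ⊕ h) ⊛ f ≈ (g ⊛ f) ⊕ (h ⊛ f)
⊛-distribʳ-⊕ f g h =
  ≈-trans (⊛-comm (g ⊕ h) f) (≈-trans (⊛-distribˡ-⊕ f g h) (⊕-cong (⊛-comm f g) (⊛-comm f h)))

·-⊛-assoc : ∀ c f g → (c · f) ⊛ g ≈ c · (f ⊛ g)
·-⊛-assoc c f g n =
  trans (Σ<-cong (suc n) (λ k _ → ℤ.*-assoc c (f k) (g (n ∸ k)))) (sym (*-distribˡ-Σ< (suc n) c _))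

⊛-·-comm : ∀ c f g → f ⊛ (c · g) ≈ c · (f ⊛ g)
⊛-·-comm c f g = ≈-trans (⊛-comm f (c · g)) (≈-trans (·-⊛-assoc c g f) (·-cong c (⊛-comm g f)))

·-distrib-⊕ : ∀ c f g → c · (f ⊕ g) ≈ (c · f) ⊕ (c · g)
·-distrib-⊕ c f g n = ℤ.*-distribˡ-+ c (f n) (g n)

·-assoc : ∀ c d f → c · (d · f) ≈ (c *ᶻ d) · f
·-assoc c d f n = sym (ℤ.*-assoc c d (f n))

⊕-comm : ∀ f g → f ⊕ g ≈ g ⊕ f
⊕-comm f g n = ℤ.+-comm (f n) (g n)

⊕-identityˡ : ∀ f → zeroPS ⊕ f ≈ f
⊕-identityˡ f n = ℤ.+-identityˡ (f n)

·-identityˡ : ∀ f → + 1 · f ≈ f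
·-identityˡ f n = ℤ.*-identityˡ (f n)

⊛-zeroʳ : ∀ f → f ⊛ zeroPS ≈ zeroPS
⊛-zeroʳ f n = Σ<-zero (suc n) (λ k _ → ℤ.*-zeroʳ (f k))

zpow-≡ : ∀ e → zpow e e ≡ + 1
zpow-≡ e with e ℕ.≟ e
... | yes _ = refl
... | no e≢e = ⊥-elim (e≢e refl)

zpow-≢ : ∀ e k → k ≢ e → zpow e k ≡ + 0
zpow-≢ e k k≢e with k ℕ.≟ e
... | yes k≡e = ⊥-elim (k≢e k≡e)
... | no _ = refl

shift-≤ : ∀ e f n → e ≤ n → shift e f n ≡ f (n ∸ e)
shift-≤ e f n e≤n with e ≤? n
... | yes _ = refl
... | no e≰n = ⊥-elim (e≰n e≤n)

shift-> : ∀ e f n → n < e → shift e f n ≡ + 0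
shift-> e f n n<e with e ≤? n
... | yes e≤n = ⊥-elim (ℕ.<⇒≱ n<e e≤n)
... | no _ = refl

zpow-⊛ : ∀ e f → zpow e ⊛ f ≈ shift e f
zpow-⊛ e f n with e ≤? n
... | yes e≤n = trans (Σ<-single (suc n) e _ (s≤s e≤n) (λ k _ k≢e → cong (_*ᶻ f (n ∸ k)) (zpow-≢ e k k≢e)))
                      (trans (cong (_*ᶻ f (n ∸ e)) (zpow-≡ e)) (ℤ.*-identityˡ _))
... | no e≰n = Σ<-zero (suc n) (λ k k<1+n → cong (_*ᶻ f (n ∸ k))
                 (zpow-≢ e k (λ { refl → e≰n (ℕ.≤-pred k<1+n) })))

⊛-identityˡ : ∀ f → onePS ⊛ f ≈ f
⊛-identityˡ f n = trans (zpow-⊛ 0 f n) (shift-≤ 0 f n z≤n)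

⊛-identityʳ : ∀ f → f ⊛ onePS ≈ f
⊛-identityʳ f = ≈-trans (⊛-comm f onePS) (⊛-identityˡ f)

⊛-commutativeMonoid : CommutativeMonoid _ _
⊛-commutativeMonoid = record
  { Carrier = PS ; _≈_ = _≈_ ; _∙_ = _⊛_ ; ε = onePS
  ; isCommutativeMonoid = record
    { isMonoid = record
      { isSemigroup = record
        { isMagma = record { isEquivalence = ≈-isEquivalence ; ∙-cong = ⊛-cong }
        ; assoc = ⊛-assoc }
      ; identity = ⊛-identityˡ , ⊛-identityʳ }
    ; comm = ⊛-comm } }

open import Algebra.Solver.CommutativeMonoid ⊛-commutativeMonoid
  using (solve; _⊜_) renaming (_⊕_ to _⊛′_)

⊛-interchange : ∀ a b c d → (a ⊛ b) ⊛ (c ⊛ d) ≈ (a ⊛ c) ⊛ (b ⊛ d)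
⊛-interchange = solve 4 (λ a b c d → (a ⊛′ b) ⊛′ (c ⊛′ d) ⊜ (a ⊛′ c) ⊛′ (b ⊛′ d)) ≈-refl

⊛-comm-middle : ∀ a b c → a ⊛ (b ⊛ c) ≈ b ⊛ (a ⊛ c)
⊛-comm-middle = solve 3 (λ a b c → a ⊛′ (b ⊛′ c) ⊜ b ⊛′ (a ⊛′ c)) ≈-refl

⊛-comm-right : ∀ a b c → (a ⊛ b) ⊛ c ≈ (a ⊛ c) ⊛ b
⊛-comm-right = solve 3 (λ a b c → (a ⊛′ b) ⊛′ c ⊜ (a ⊛′ c) ⊛′ b) ≈-refl

zpow-+ : ∀ a b → zpow a ⊛ zpow b ≈ zpow (a + b)
zpow-+ a b n = trans (zpow-⊛ a (zpow b) n) (shifted (a ≤? n))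
  where
  shifted : Dec (a ≤ n) → shift a (zpow b) n ≡ zpow (a + b) n
  shifted (yes a≤n) rewrite shift-≤ a (zpow b) n a≤n with n ∸ a ℕ.≟ b | n ℕ.≟ a + b
  ... | yes _ | yes _ = refl
  ... | no _  | no _  = refl
  ... | yes n∸a≡b | no n≢a+b = ⊥-elim (n≢a+b (trans (sym (ℕ.m+[n∸m]≡n a≤n)) (cong (λ x → a + x) n∸a≡b)))
  ... | no n∸a≢b | yes refl  = ⊥-elim (n∸a≢b (ℕ.m+n∸m≡n a b))
  shifted (no a≰n) = trans (shift-> a (zpow b) n (ℕ.≰⇒> a≰n))
                           (sym (zpow-≢ (a + b) n (λ { refl → a≰n (ℕ.m≤m+n a b) })))

zpow-⊛-assoc : ∀ a b f → zpow a ⊛ (zpow b ⊛ f) ≈ zpow (a + b) ⊛ f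
zpow-⊛-assoc a b f = ≈-trans (≈-sym (⊛-assoc (zpow a) (zpow b) f)) (⊛-congˡ f (zpow-+ a b))

zpow-cong : ∀ {a b} → a ≡ b → zpow a ≈ zpow b
zpow-cong refl = ≈-refl

oneMinus-⊛ : ∀ e f → oneMinus e ⊛ f ≈ f ⊕ (-[1+ 0 ] · (zpow e ⊛ f))
oneMinus-⊛ e f = ≈-trans (⊛-distribʳ-⊕ f onePS (-[1+ 0 ] · zpow e)) (⊕-cong (⊛-identityˡ f) (·-⊛-assoc -[1+ 0 ] (zpow e) f))

oneMinus-⊛-coeff : ∀ e f n → (oneMinus e ⊛ f) n ≡ f n +ᶻ -[1+ 0 ] *ᶻ shift e f n
oneMinus-⊛-coeff e f n = trans (oneMinus-⊛ e f n) (cong (λ x → f n +ᶻ -[1+ 0 ] *ᶻ x) (zpow-⊛ e f n))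

oneMinus-+ : ∀ s t → oneMinus (s + t) ≈ oneMinus s ⊕ (zpow s ⊛ oneMinus t)
oneMinus-+ s t n = begin
  oneMinus (s + t) n                                                         ≡⟨ telescope (onePS n) (zpow s n) (zpow (s + t) n) ⟨
  oneMinus s n +ᶻ (zpow s n +ᶻ -[1+ 0 ] *ᶻ zpow (s + t) n)                   ≡⟨ cong (oneMinus s n +ᶻ_) (zpowOneMinus n) ⟨
  oneMinus s n +ᶻ (zpow s ⊛ oneMinus t) n                                    ∎
  where
  open ≡-Reasoning
  telescope : ∀ a b c → (a +ᶻ -[1+ 0 ] *ᶻ b) +ᶻ (b +ᶻ -[1+ 0 ] *ᶻ c) ≡ a +ᶻ -[1+ 0 ] *ᶻ c
  telescope = ℤ-Solver.solve-∀
  zpowOneMinus : zpow s ⊛ oneMinus t ≈ zpow s ⊕ (-[1+ 0 ] · zpow (s + t))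
  zpowOneMinus = ≈-trans (⊛-distribˡ-⊕ (zpow s) onePS (-[1+ 0 ] · zpow t))
    (⊕-cong (⊛-identityʳ (zpow s)) (≈-trans (⊛-·-comm -[1+ 0 ] (zpow s) (zpow t)) (·-cong -[1+ 0 ] (zpow-+ s t))))

ΣPS<-coeff : ∀ n F k → ΣPS< n F k ≡ Σ< n (λ i → F i k)
ΣPS<-coeff zero    F k = refl
ΣPS<-coeff (suc n) F k = cong (_+ᶻ F n k) (ΣPS<-coeff n F k)

ΣPS<-cong : ∀ n {F G} → (∀ i → i < n → F i ≈ G i) → ΣPS< n F ≈ ΣPS< n G
ΣPS<-cong n F≈G k =
  trans (ΣPS<-coeff n _ k) (trans (Σ<-cong n (λ i i<n → F≈G i i<n k)) (sym (ΣPS<-coeff n _ k)))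

ΣPS<-distrib-⊕ : ∀ n F G → ΣPS< n (λ i → F i ⊕ G i) ≈ ΣPS< n F ⊕ ΣPS< n G
ΣPS<-distrib-⊕ n F G k = trans (ΣPS<-coeff n _ k) (trans (Σ<-distrib-+ n (λ i → F i k) (λ i → G i k))
  (sym (cong₂ _+ᶻ_ (ΣPS<-coeff n F k) (ΣPS<-coeff n G k))))

ΣPS<-sucˡ : ∀ n F → ΣPS< (suc n) F ≈ F 0 ⊕ ΣPS< n (λ i → F (suc i))
ΣPS<-sucˡ n F k = trans (ΣPS<-coeff (suc n) F k) (trans (Σ<-sucˡ n (λ i → F i k))
  (cong (F 0 k +ᶻ_) (sym (ΣPS<-coeff n (λ i → F (suc i)) k))))

⊛-distribˡ-ΣPS< : ∀ n f F → f ⊛ ΣPS< n F ≈ ΣPS< n (λ i → f ⊛ F i)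
⊛-distribˡ-ΣPS< zero    f F = ⊛-zeroʳ f
⊛-distribˡ-ΣPS< (suc n) f F = ≈-trans (⊛-distribˡ-⊕ f (ΣPS< n F) (F n)) (⊕-cong (⊛-distribˡ-ΣPS< n f F) ≈-refl)

·-distrib-ΣPS< : ∀ n c F → c · ΣPS< n F ≈ ΣPS< n (λ i → c · F i)
·-distrib-ΣPS< zero    c F k = ℤ.*-zeroʳ c
·-distrib-ΣPS< (suc n) c F = ≈-trans (·-distrib-⊕ c (ΣPS< n F) (F n)) (⊕-cong (·-distrib-ΣPS< n c F) ≈-refl)

-- Pochhammer symbols, their inverses and Gaussian binomials

geomInv-coeff-∤ : ∀ i n → ¬ suc i ∣ n → geomInv i n ≡ + 0
geomInv-coeff-∤ i n i+1∤n with suc i ∣? n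
... | yes ∣ = ⊥-elim (i+1∤n ∣)
... | no _ = refl

oneMinus-⊛-geomInv : ∀ i → oneMinus (suc i) ⊛ geomInv i ≈ onePS
oneMinus-⊛-geomInv i n = trans (oneMinus-⊛-coeff (suc i) (geomInv i) n) (telescoped (suc i ≤? n))
  where
  periodic : suc i ≤ n → geomInv i n ≡ geomInv i (n ∸ suc i)
  periodic i<n with suc i ∣? n | suc i ∣? (n ∸ suc i)
  ... | yes _ | yes _ = refl
  ... | no _  | no _  = refl
  ... | yes ∣n | no ∤n-i = ⊥-elim (∤n-i (∣m+n∣m⇒∣n (subst (suc i ∣_) (sym (ℕ.m+[n∸m]≡n i<n)) ∣n) ∣-refl))
  ... | no ∤n | yes ∣n-i = ⊥-elim (∤n (∣m∸n∣n⇒∣m (suc i) i<n ∣n-i ∣-refl))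
  telescoped : Dec (suc i ≤ n) → geomInv i n +ᶻ -[1+ 0 ] *ᶻ shift (suc i) (geomInv i) n ≡ onePS n
  telescoped (yes i<n) = begin
    geomInv i n +ᶻ -[1+ 0 ] *ᶻ shift (suc i) (geomInv i) n
      ≡⟨ cong (λ x → geomInv i n +ᶻ -[1+ 0 ] *ᶻ x) (trans (shift-≤ (suc i) (geomInv i) n i<n) (sym (periodic i<n))) ⟩
    geomInv i n +ᶻ -[1+ 0 ] *ᶻ geomInv i n
      ≡⟨ cancel (geomInv i n) ⟩
    + 0
      ≡⟨ zpow-≢ 0 n (ℕ.n>0⇒n≢0 (ℕ.<-≤-trans (s≤s z≤n) i<n)) ⟨
    onePS n ∎
    where
    open ≡-Reasoning
    cancel : ∀ x → x +ᶻ -[1+ 0 ] *ᶻ x ≡ + 0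
    cancel = ℤ-Solver.solve-∀
  telescoped (no i≮n) rewrite shift-> (suc i) (geomInv i) n (ℕ.≰⇒> i≮n) =
    trans (ℤ.+-identityʳ _) (noPole n i≮n)
    where
    noPole : ∀ m → ¬ suc i ≤ m → geomInv i m ≡ onePS m
    noPole zero    _    = refl
    noPole (suc m) i≮m = geomInv-coeff-∤ i (suc m) (i≮m ∘ ∣⇒≤)

poch : ℕ → PS
poch n = qpoch 1 1 n

poch-suc : ∀ n → poch (suc n) ≈ poch n ⊛ oneMinus (suc n)
poch-suc n = ⊛-congʳ (poch n) (≡⇒≈ (cong (oneMinus ∘ suc) (ℕ.+-identityʳ n)))

poch-⊛-invPoch : ∀ n → poch n ⊛ invPoch n ≈ onePS
poch-⊛-invPoch zero    = ⊛-identityˡ onePS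
poch-⊛-invPoch (suc n) = begin
  poch (suc n) ⊛ (invPoch n ⊛ geomInv n)                    ≈⟨ ⊛-congˡ (invPoch n ⊛ geomInv n) (poch-suc n) ⟩
  (poch n ⊛ oneMinus (suc n)) ⊛ (invPoch n ⊛ geomInv n)     ≈⟨ ⊛-interchange (poch n) (oneMinus (suc n)) (invPoch n) (geomInv n) ⟩
  (poch n ⊛ invPoch n) ⊛ (oneMinus (suc n) ⊛ geomInv n)     ≈⟨ ⊛-cong (poch-⊛-invPoch n) (oneMinus-⊛-geomInv n) ⟩
  onePS ⊛ onePS                                             ≈⟨ ⊛-identityˡ onePS ⟩
  onePS                                                     ∎
  where open SetoidReasoning

oneMinus-⊛-invPoch : ∀ k → oneMinus (suc k) ⊛ invPoch (suc k) ≈ invPoch k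
oneMinus-⊛-invPoch k = begin
  oneMinus (suc k) ⊛ (invPoch k ⊛ geomInv k)   ≈⟨ ⊛-comm-middle (oneMinus (suc k)) (invPoch k) (geomInv k) ⟩
  invPoch k ⊛ (oneMinus (suc k) ⊛ geomInv k)   ≈⟨ ⊛-congʳ (invPoch k) (oneMinus-⊛-geomInv k) ⟩
  invPoch k ⊛ onePS                            ≈⟨ ⊛-identityʳ (invPoch k) ⟩
  invPoch k                                    ∎
  where open SetoidReasoning

-- [a + b choose a]_z, written symmetrically in a and b
binom : ℕ → ℕ → PS
binom a b = (poch (a + b) ⊛ invPoch a) ⊛ invPoch b

binom-zeroʳ : ∀ a → binom a 0 ≈ onePS
binom-zeroʳ a = begin
  (poch (a + 0) ⊛ invPoch a) ⊛ onePS   ≈⟨ ⊛-identityʳ (poch (a + 0) ⊛ invPoch a) ⟩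
  poch (a + 0) ⊛ invPoch a             ≈⟨ ⊛-congˡ (invPoch a) (≡⇒≈ (cong poch (ℕ.+-identityʳ a))) ⟩
  poch a ⊛ invPoch a                   ≈⟨ poch-⊛-invPoch a ⟩
  onePS                                ∎
  where open SetoidReasoning

binom-zeroˡ : ∀ b → binom 0 b ≈ onePS
binom-zeroˡ b = ≈-trans (⊛-congˡ (invPoch b) (⊛-identityʳ (poch b))) (poch-⊛-invPoch b)

binom-comm : ∀ a b → binom a b ≈ binom b a
binom-comm a b = ≈-trans (⊛-congˡ (invPoch b) (⊛-congˡ (invPoch a) (≡⇒≈ (cong poch (ℕ.+-comm a b)))))
                         (⊛-comm-right (poch (b + a)) (invPoch a) (invPoch b))

binom-pascal : ∀ a b → binom (suc a) (suc b) ≈ binom a (suc b) ⊕ (zpow (suc a) ⊛ binom (suc a) b)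
binom-pascal a b = begin
  (poch (suc (a + suc b)) ⊛ I₁) ⊛ J₁
    ≈⟨ ⊛-congˡ J₁ (⊛-congˡ I₁ (≈-trans (poch-suc (a + suc b)) (⊛-congʳ Q (oneMinus-+ (suc a) (suc b))))) ⟩
  ((Q ⊛ (A₁ ⊕ (Z ⊛ B₁))) ⊛ I₁) ⊛ J₁
    ≈⟨ ⊛-congˡ J₁ (≈-trans (⊛-congˡ I₁ (⊛-distribˡ-⊕ Q A₁ (Z ⊛ B₁)))
                           (⊛-distribʳ-⊕ I₁ (Q ⊛ A₁) (Q ⊛ (Z ⊛ B₁)))) ⟩
  (((Q ⊛ A₁) ⊛ I₁) ⊕ ((Q ⊛ (Z ⊛ B₁)) ⊛ I₁)) ⊛ J₁
    ≈⟨ ⊛-distribʳ-⊕ J₁ ((Q ⊛ A₁) ⊛ I₁) ((Q ⊛ (Z ⊛ B₁)) ⊛ I₁) ⟩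
  (((Q ⊛ A₁) ⊛ I₁) ⊛ J₁) ⊕ (((Q ⊛ (Z ⊛ B₁)) ⊛ I₁) ⊛ J₁)
    ≈⟨ ⊕-cong (rearrange₁ Q A₁ I₁ J₁) (rearrange₂ Q Z B₁ I₁ J₁) ⟩
  ((Q ⊛ (A₁ ⊛ I₁)) ⊛ J₁) ⊕ (Z ⊛ ((Q ⊛ I₁) ⊛ (B₁ ⊛ J₁)))
    ≈⟨ ⊕-cong (⊛-congˡ J₁ (⊛-congʳ Q (oneMinus-⊛-invPoch a)))
              (⊛-congʳ Z (⊛-cong (⊛-congˡ I₁ (≡⇒≈ (cong poch (ℕ.+-suc a b)))) (oneMinus-⊛-invPoch b))) ⟩
  binom a (suc b) ⊕ (Z ⊛ binom (suc a) b)
    ∎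
  where
  open SetoidReasoning
  Q = poch (a + suc b)
  Z = zpow (suc a)
  A₁ = oneMinus (suc a)
  B₁ = oneMinus (suc b)
  I₁ = invPoch (suc a)
  J₁ = invPoch (suc b)
  rearrange₁ : ∀ q x y w → ((q ⊛ x) ⊛ y) ⊛ w ≈ (q ⊛ (x ⊛ y)) ⊛ w
  rearrange₁ = solve 4 (λ q x y w → ((q ⊛′ x) ⊛′ y) ⊛′ w ⊜ (q ⊛′ (x ⊛′ y)) ⊛′ w) ≈-refl
  rearrange₂ : ∀ q z x y w → ((q ⊛ (z ⊛ x)) ⊛ y) ⊛ w ≈ z ⊛ ((q ⊛ y) ⊛ (x ⊛ w))
  rearrange₂ = solve 5 (λ q z x y w → ((q ⊛′ (z ⊛′ x)) ⊛′ y) ⊛′ w ⊜ z ⊛′ ((q ⊛′ y) ⊛′ (x ⊛′ w))) ≈-refl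

binom-pascal′ : ∀ a b → binom (suc a) (suc b) ≈ binom (suc a) b ⊕ (zpow (suc b) ⊛ binom a (suc b))
binom-pascal′ a b = begin
  binom (suc a) (suc b)                                  ≈⟨ binom-comm (suc a) (suc b) ⟩
  binom (suc b) (suc a)                                  ≈⟨ binom-pascal b a ⟩
  binom b (suc a) ⊕ (zpow (suc b) ⊛ binom (suc b) a)
    ≈⟨ ⊕-cong (binom-comm b (suc a)) (⊛-congʳ (zpow (suc b)) (binom-comm (suc b) a)) ⟩
  binom (suc a) b ⊕ (zpow (suc b) ⊛ binom a (suc b))     ∎
  where open SetoidReasoning

gauss≈binom : ∀ N m → gauss N m ≈ binom m N
gauss≈binom N m = ⊛-congˡ (invPoch N) (⊛-congˡ (invPoch m) (≡⇒≈ (cong poch (ℕ.+-comm N m))))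

-- Counting partitions

count : ℕ → List (List ℕ) → ℕ
count n xss = length (filter (λ xs → sum xs ℕ.≟ n) xss)

count-++ : ∀ n xss yss → count n (xss ++ yss) ≡ count n xss + count n yss
count-++ n xss yss = trans (cong length (filter-++ (λ xs → sum xs ℕ.≟ n) xss yss)) (length-++ (filter _ xss))

count-accept : ∀ {n} xs xss → sum xs ≡ n → count n (xs ∷ xss) ≡ suc (count n xss)
count-accept {n} xs xss s≡n = cong length (filter-accept (λ ys → sum ys ℕ.≟ n) {xs} {xss} s≡n)

count-reject : ∀ {n} xs xss → sum xs ≢ n → count n (xs ∷ xss) ≡ count n xss
count-reject {n} xs xss s≢n = cong length (filter-reject (λ ys → sum ys ℕ.≟ n) {xs} {xss} s≢n)

count-map-∷-≤ : ∀ n k xss → k ≤ n → count n (List.map (k ∷_) xss) ≡ count (n ∸ k) xss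
count-map-∷-≤ n k []         k≤n = refl
count-map-∷-≤ n k (xs ∷ xss) k≤n with sum xs ℕ.≟ n ∸ k
... | yes s≡n-k = trans (count-accept (k ∷ xs) _ (trans (cong (λ s → k + s) s≡n-k) (ℕ.m+[n∸m]≡n k≤n)))
                        (trans (cong suc (count-map-∷-≤ n k xss k≤n)) (sym (count-accept xs xss s≡n-k)))
... | no s≢n-k  = trans (count-reject (k ∷ xs) _ (λ k+s≡n → s≢n-k (trans (sym (ℕ.m+n∸m≡n k (sum xs))) (cong (_∸ k) k+s≡n))))
                        (trans (count-map-∷-≤ n k xss k≤n) (sym (count-reject xs xss s≢n-k)))

count-map-∷-> : ∀ n k xss → n < k → count n (List.map (k ∷_) xss) ≡ 0
count-map-∷-> n k []         n<k = refl
count-map-∷-> n k (xs ∷ xss) n<k =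
  trans (count-reject (k ∷ xs) _ (λ { refl → ℕ.<⇒≱ n<k (ℕ.m≤m+n k (sum xs)) })) (count-map-∷-> n k xss n<k)

nonincr-suc : ∀ m b → nonincr (suc m) (suc b) ≡ nonincr (suc m) b ++ List.map (suc b ∷_) (nonincr m (suc b))
nonincr-suc m b = begin
  concatMap startingWith (upTo (suc (suc b)))                   ≡⟨ cong (concatMap startingWith) (upTo-∷ʳ (suc b)) ⟨
  concatMap startingWith (upTo (suc b) ∷ʳ suc b)                ≡⟨ concatMap-++ startingWith (upTo (suc b)) (suc b ∷ []) ⟩
  concatMap startingWith (upTo (suc b)) ++ startingWith (suc b) ++ []
                                                                ≡⟨ cong (concatMap startingWith (upTo (suc b)) ++_) (++-identityʳ _) ⟩
  concatMap startingWith (upTo (suc b)) ++ startingWith (suc b) ∎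
  where
  open ≡-Reasoning
  startingWith : ℕ → List (List ℕ)
  startingWith k = List.map (k ∷_) (nonincr m k)

partitionSeries : ℕ → ℕ → PS
partitionSeries m b n = + p n m b

partitionSeries-suc : ∀ m b →
  partitionSeries (suc m) (suc b) ≈ partitionSeries (suc m) b ⊕ shift (suc b) (partitionSeries m (suc b))
partitionSeries-suc m b n
  rewrite nonincr-suc m b | count-++ n (nonincr (suc m) b) (List.map (suc b ∷_) (nonincr m (suc b)))
  with suc b ≤? n
... | yes b<n = trans (ℤ.pos-+ (p n (suc m) b) _)
                    (cong (λ c → + p n (suc m) b +ᶻ + c) (count-map-∷-≤ n (suc b) (nonincr m (suc b)) b<n))
... | no b≮n  = trans (ℤ.pos-+ (p n (suc m) b) _)
                    (cong (λ c → + p n (suc m) b +ᶻ + c) (count-map-∷-> n (suc b) (nonincr m (suc b)) (ℕ.≰⇒> b≮n)))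

partitionSeries-zeroˡ : ∀ b → partitionSeries 0 b ≈ onePS
partitionSeries-zeroˡ b zero    = refl
partitionSeries-zeroˡ b (suc n) = refl

partitionSeries-zeroʳ : ∀ m → partitionSeries m 0 ≈ onePS
partitionSeries-zeroʳ zero    = partitionSeries-zeroˡ 0
partitionSeries-zeroʳ (suc m) n =
  trans (cong (λ xss → + count n xss) (++-identityʳ (List.map (0 ∷_) (nonincr m 0))))
        (trans (cong +_ (count-map-∷-≤ n 0 (nonincr m 0) z≤n)) (partitionSeries-zeroʳ m n))

partitionSeries≈binom : ∀ m b → partitionSeries m b ≈ binom m b
partitionSeries≈binom zero    b       = ≈-trans (partitionSeries-zeroˡ b) (≈-sym (binom-zeroˡ b))
partitionSeries≈binom (suc m) zero    = ≈-trans (partitionSeries-zeroʳ (suc m)) (≈-sym (binom-zeroʳ (suc m)))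
partitionSeries≈binom (suc m) (suc b) = begin
  partitionSeries (suc m) (suc b)                                          ≈⟨ partitionSeries-suc m b ⟩
  partitionSeries (suc m) b ⊕ shift (suc b) (partitionSeries m (suc b))    ≈⟨ ⊕-cong (partitionSeries≈binom (suc m) b)
                                                                                        (≈-sym (zpow-⊛ (suc b) (partitionSeries m (suc b)))) ⟩
  binom (suc m) b ⊕ (zpow (suc b) ⊛ partitionSeries m (suc b))             ≈⟨ ⊕-cong (≈-refl {binom (suc m) b}) (⊛-congʳ (zpow (suc b))
                                                                                        (partitionSeries≈binom m (suc b))) ⟩
  binom (suc m) b ⊕ (zpow (suc b) ⊛ binom m (suc b))                       ≈⟨ binom-pascal′ m b ⟨
  binom (suc m) (suc b)                                                    ∎
  where open SetoidReasoning

partitionSeries≈gauss : ∀ m N → partitionSeries m N ≈ gauss N m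
partitionSeries≈gauss m N = ≈-trans (partitionSeries≈binom m N) (≈-sym (gauss≈binom N m))

-- Cauchy's q-binomial theorem

triangular : ℕ → ℕ
triangular zero    = 0
triangular (suc i) = triangular i + suc i

sign : ℕ → ℤ
sign i = -[1+ 0 ] ℤ.^ i

-- (z^(N+1); z)_m = (z;z)_(N+m) / (z;z)_N
risingPoch : ℕ → ℕ → PS
risingPoch m N = poch (N + m) ⊛ invPoch N

risingPoch-suc : ∀ m N → risingPoch (suc m) N ≈ oneMinus (suc N) ⊛ risingPoch m (suc N)
risingPoch-suc m N = begin
  poch (N + suc m) ⊛ invPoch N
    ≈⟨ ⊛-cong (≡⇒≈ (cong poch (ℕ.+-suc N m))) (≈-sym (oneMinus-⊛-invPoch N)) ⟩
  poch (suc N + m) ⊛ (oneMinus (suc N) ⊛ invPoch (suc N))    ≈⟨ ⊛-comm-middle (poch (suc N + m)) (oneMinus (suc N)) (invPoch (suc N)) ⟩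
  oneMinus (suc N) ⊛ risingPoch m (suc N)                    ∎
  where open SetoidReasoning

cauchyTerm : ℕ → ℕ → ℕ → PS
cauchyTerm m N i = sign i · (zpow (triangular i + N * i) ⊛ binom i (m ∸ i))

cauchyTerm-zero : ∀ m N → cauchyTerm m N 0 ≈ onePS
cauchyTerm-zero m N = begin
  + 1 · (zpow (N * 0) ⊛ binom 0 m)   ≈⟨ ·-identityˡ _ ⟩
  zpow (N * 0) ⊛ binom 0 m           ≈⟨ ⊛-cong (zpow-cong (ℕ.*-zeroʳ N)) (binom-zeroˡ m) ⟩
  onePS ⊛ onePS                      ≈⟨ ⊛-identityˡ onePS ⟩
  onePS                              ∎
  where open SetoidReasoning

-zpow-⊛-cauchyTerm : ∀ m N i →
  -[1+ 0 ] · (zpow (suc N) ⊛ cauchyTerm m (suc N) i)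
    ≈ sign (suc i) · (zpow (triangular (suc i) + N * suc i) ⊛ binom i (m ∸ i))
-zpow-⊛-cauchyTerm m N i = begin
  -[1+ 0 ] · (zpow (suc N) ⊛ (sign i · (zpow e ⊛ B)))   ≈⟨ ·-cong -[1+ 0 ] (⊛-·-comm (sign i) (zpow (suc N)) (zpow e ⊛ B)) ⟩
  -[1+ 0 ] · (sign i · (zpow (suc N) ⊛ (zpow e ⊛ B)))   ≈⟨ ·-assoc -[1+ 0 ] (sign i) _ ⟩
  sign (suc i) · (zpow (suc N) ⊛ (zpow e ⊛ B))          ≈⟨ ·-cong (sign (suc i)) (≈-trans (zpow-⊛-assoc (suc N) e B)
                                                              (⊛-congˡ B (zpow-cong (exponent N i (triangular i))))) ⟩
  sign (suc i) · (zpow (triangular (suc i) + N * suc i) ⊛ B) ∎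
  where
  open SetoidReasoning
  e = triangular i + suc N * i
  B = binom i (m ∸ i)
  exponent : ∀ N i t → suc N + (t + suc N * i) ≡ t + suc i + N * suc i
  exponent = ℕ-Solver.solve-∀

cauchyTerm-suc : ∀ m N i → i < m →
  cauchyTerm (suc m) N (suc i) ≈ cauchyTerm m (suc N) (suc i) ⊕ (-[1+ 0 ] · (zpow (suc N) ⊛ cauchyTerm m (suc N) i))
cauchyTerm-suc m N i i<m = begin
  s · (Z ⊛ binom (suc i) (m ∸ i))
    ≈⟨ ·-cong s (⊛-congʳ Z (≈-trans (≡⇒≈ (cong (binom (suc i)) (ℕ.+-∸-assoc 1 i<m))) (binom-pascal i (m ∸ suc i)))) ⟩
  s · (Z ⊛ (binom i (suc (m ∸ suc i)) ⊕ (zpow (suc i) ⊛ binom (suc i) (m ∸ suc i))))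
    ≈⟨ ≈-trans (·-cong s (⊛-distribˡ-⊕ Z B₁ (zpow (suc i) ⊛ B₂)))
               (·-distrib-⊕ s (Z ⊛ B₁) (Z ⊛ (zpow (suc i) ⊛ B₂))) ⟩
  (s · (Z ⊛ binom i (suc (m ∸ suc i)))) ⊕ (s · (Z ⊛ (zpow (suc i) ⊛ binom (suc i) (m ∸ suc i))))
    ≈⟨ ⊕-cong (·-cong s (⊛-congʳ Z (≡⇒≈ (cong (binom i) (sym (ℕ.+-∸-assoc 1 i<m))))))
              (·-cong s (≈-trans (zpow-⊛-assoc e (suc i) B₂) (⊛-congˡ B₂ (zpow-cong (exponent (triangular (suc i)) N (suc i)))))) ⟩
  (s · (Z ⊛ binom i (m ∸ i))) ⊕ cauchyTerm m (suc N) (suc i)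
    ≈⟨ ⊕-cong (≈-sym (-zpow-⊛-cauchyTerm m N i)) ≈-refl ⟩
  (-[1+ 0 ] · (zpow (suc N) ⊛ cauchyTerm m (suc N) i)) ⊕ cauchyTerm m (suc N) (suc i)
    ≈⟨ ⊕-comm (-[1+ 0 ] · (zpow (suc N) ⊛ cauchyTerm m (suc N) i)) (cauchyTerm m (suc N) (suc i)) ⟩
  cauchyTerm m (suc N) (suc i) ⊕ (-[1+ 0 ] · (zpow (suc N) ⊛ cauchyTerm m (suc N) i))
    ∎
  where
  open SetoidReasoning
  s = sign (suc i)
  e = triangular (suc i) + N * suc i
  Z = zpow e
  B₁ = binom i (suc (m ∸ suc i))
  B₂ = binom (suc i) (m ∸ suc i)
  exponent : ∀ t N k → t + N * k + k ≡ t + (k + N * k)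
  exponent = ℕ-Solver.solve-∀

cauchyTerm-last : ∀ m N → cauchyTerm (suc m) N (suc m) ≈ -[1+ 0 ] · (zpow (suc N) ⊛ cauchyTerm m (suc N) m)
cauchyTerm-last m N = begin
  sign (suc m) · (zpow e ⊛ binom (suc m) (m ∸ m))
    ≈⟨ ·-cong (sign (suc m)) (⊛-congʳ (zpow e) (≈-trans (binom-m-m (suc m)) (≈-sym (binom-m-m m)))) ⟩
  sign (suc m) · (zpow e ⊛ binom m (m ∸ m))
    ≈⟨ ≈-sym (-zpow-⊛-cauchyTerm m N m) ⟩
  -[1+ 0 ] · (zpow (suc N) ⊛ cauchyTerm m (suc N) m)
    ∎
  where
  open SetoidReasoning
  e = triangular (suc m) + N * suc m
  binom-m-m : ∀ k → binom k (m ∸ m) ≈ onePS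
  binom-m-m k = ≈-trans (≡⇒≈ (cong (binom k) (ℕ.n∸n≡0 m))) (binom-zeroʳ k)

risingPoch≈Σ : ∀ m N → risingPoch m N ≈ ΣPS< (suc m) (cauchyTerm m N)
risingPoch≈Σ zero N = begin
  poch (N + 0) ⊛ invPoch N   ≈⟨ ⊛-congˡ (invPoch N) (≡⇒≈ (cong poch (ℕ.+-identityʳ N))) ⟩
  poch N ⊛ invPoch N         ≈⟨ poch-⊛-invPoch N ⟩
  onePS                      ≈⟨ ≈-sym (≈-trans (⊕-identityˡ (cauchyTerm 0 N 0)) (cauchyTerm-zero 0 N)) ⟩
  ΣPS< 1 (cauchyTerm 0 N)    ∎
  where open SetoidReasoning
risingPoch≈Σ (suc m) N = begin
  risingPoch (suc m) N                               ≈⟨ risingPoch-suc m N ⟩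
  oneMinus (suc N) ⊛ risingPoch m (suc N)            ≈⟨ ⊛-congʳ (oneMinus (suc N)) (risingPoch≈Σ m (suc N)) ⟩
  oneMinus (suc N) ⊛ ΣPS< (suc m) u                  ≈⟨ oneMinus-⊛ (suc N) (ΣPS< (suc m) u) ⟩
  ΣPS< (suc m) u ⊕ (-[1+ 0 ] · (zpow (suc N) ⊛ ΣPS< (suc m) u))
    ≈⟨ ⊕-cong (ΣPS<-sucˡ m u) (≈-trans (·-cong -[1+ 0 ] (⊛-distribˡ-ΣPS< (suc m) (zpow (suc N)) u))
                                       (·-distrib-ΣPS< (suc m) -[1+ 0 ] _)) ⟩
  (u 0 ⊕ ΣPS< m (u ∘ suc)) ⊕ (ΣPS< m v ⊕ v m)       ≈⟨ regroup (u 0) (ΣPS< m (u ∘ suc)) (ΣPS< m v) (v m) ⟩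
  (u 0 ⊕ (ΣPS< m (u ∘ suc) ⊕ ΣPS< m v)) ⊕ v m
    ≈⟨ ⊕-cong (⊕-cong (≈-trans (cauchyTerm-zero m (suc N)) (≈-sym (cauchyTerm-zero (suc m) N)))
                      (≈-trans (≈-sym (ΣPS<-distrib-⊕ m (u ∘ suc) v)) (ΣPS<-cong m (λ i i<m → ≈-sym (cauchyTerm-suc m N i i<m)))))
              (≈-sym (cauchyTerm-last m N)) ⟩
  (t 0 ⊕ ΣPS< m (t ∘ suc)) ⊕ t (suc m)              ≈⟨ ⊕-cong (≈-sym (ΣPS<-sucˡ m t)) ≈-refl ⟩
  ΣPS< (suc (suc m)) t                               ∎
  where
  open SetoidReasoning
  u = cauchyTerm m (suc N)
  v = λ i → -[1+ 0 ] · (zpow (suc N) ⊛ u i)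
  t = cauchyTerm (suc m) N
  regroup : ∀ a b c d → (a ⊕ b) ⊕ (c ⊕ d) ≈ (a ⊕ (b ⊕ c)) ⊕ d
  regroup a b c d n = shuffle (a n) (b n) (c n) (d n)
    where
    shuffle : ∀ a b c d → (a +ᶻ b) +ᶻ (c +ᶻ d) ≡ (a +ᶻ (b +ᶻ c)) +ᶻ d
    shuffle = ℤ-Solver.solve-∀

invPoch-⊛-binom : ∀ a b → invPoch (a + b) ⊛ binom a b ≈ invPoch a ⊛ invPoch b
invPoch-⊛-binom a b = begin
  invPoch (a + b) ⊛ ((poch (a + b) ⊛ invPoch a) ⊛ invPoch b)   ≈⟨ regroup (invPoch (a + b)) (poch (a + b)) (invPoch a) (invPoch b) ⟩
  (poch (a + b) ⊛ invPoch (a + b)) ⊛ (invPoch a ⊛ invPoch b)   ≈⟨ ⊛-congˡ (invPoch a ⊛ invPoch b) (poch-⊛-invPoch (a + b)) ⟩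
  onePS ⊛ (invPoch a ⊛ invPoch b)                              ≈⟨ ⊛-identityˡ (invPoch a ⊛ invPoch b) ⟩
  invPoch a ⊛ invPoch b                                        ∎
  where
  open SetoidReasoning
  regroup : ∀ a b c d → a ⊛ ((b ⊛ c) ⊛ d) ≈ (b ⊛ a) ⊛ (c ⊛ d)
  regroup = solve 4 (λ a b c d → a ⊛′ ((b ⊛′ c) ⊛′ d) ⊜ (b ⊛′ a) ⊛′ (c ⊛′ d)) ≈-refl

gauss-expansion : ∀ N m →
  gauss N m ≈ ΣPS< (suc m) (λ i → sign i · (zpow (triangular i + N * i) ⊛ (invPoch i ⊛ invPoch (m ∸ i))))
gauss-expansion N m = begin
  (poch (N + m) ⊛ invPoch m) ⊛ invPoch N                ≈⟨ ⊛-comm-right (poch (N + m)) (invPoch m) (invPoch N) ⟩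
  risingPoch m N ⊛ invPoch m                            ≈⟨ ⊛-congˡ (invPoch m) (risingPoch≈Σ m N) ⟩
  ΣPS< (suc m) (cauchyTerm m N) ⊛ invPoch m             ≈⟨ ⊛-comm (ΣPS< (suc m) (cauchyTerm m N)) (invPoch m) ⟩
  invPoch m ⊛ ΣPS< (suc m) (cauchyTerm m N)             ≈⟨ ⊛-distribˡ-ΣPS< (suc m) (invPoch m) (cauchyTerm m N) ⟩
  ΣPS< (suc m) (λ i → invPoch m ⊛ cauchyTerm m N i)     ≈⟨ ΣPS<-cong (suc m) (λ i i<1+m → divideOut i (ℕ.≤-pred i<1+m)) ⟩
  ΣPS< (suc m) (λ i → sign i · (zpow (triangular i + N * i) ⊛ (invPoch i ⊛ invPoch (m ∸ i))))  ∎
  where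
  open SetoidReasoning
  divideBinom : ∀ {i} → i ≤ m → invPoch m ⊛ binom i (m ∸ i) ≈ invPoch i ⊛ invPoch (m ∸ i)
  divideBinom {i} i≤m = ≈-trans (⊛-congˡ (binom i (m ∸ i)) (≡⇒≈ (cong invPoch (sym (ℕ.m+[n∸m]≡n i≤m)))))
                                (invPoch-⊛-binom i (m ∸ i))
  divideOut : ∀ i → i ≤ m →
    invPoch m ⊛ cauchyTerm m N i ≈ sign i · (zpow (triangular i + N * i) ⊛ (invPoch i ⊛ invPoch (m ∸ i)))
  divideOut i i≤m =
    ≈-trans (⊛-·-comm (sign i) (invPoch m) (zpow (triangular i + N * i) ⊛ binom i (m ∸ i)))
            (·-cong (sign i) (≈-trans (⊛-comm-middle (invPoch m) (zpow (triangular i + N * i)) (binom i (m ∸ i)))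
                                      (⊛-congʳ (zpow (triangular i + N * i)) (divideBinom i≤m))))

-- Dissection

dissect-cong : ∀ s {f g} → f ≈ g → dissect s f ≈ dissect s g
dissect-cong s f≈g n = f≈g (s * n)

shift-cong : ∀ e {f g} → f ≈ g → shift e f ≈ shift e g
shift-cong e {f} {g} f≈g = ≈-trans (≈-sym (zpow-⊛ e f)) (≈-trans (⊛-congʳ (zpow e) f≈g) (zpow-⊛ e g))

shift-⊛ : ∀ e f g → shift e (f ⊛ g) ≈ f ⊛ shift e g
shift-⊛ e f g = ≈-trans (≈-sym (zpow-⊛ e (f ⊛ g)))
  (≈-trans (⊛-comm-middle (zpow e) f g) (⊛-congʳ f (zpow-⊛ e g)))

shift-dissect : ∀ j e f → shift e (dissect (suc j) f) ≈ dissect (suc j) (shift (suc j * e) f)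
shift-dissect j e f n with e ≤? n
... | yes e≤n = sym (trans (shift-≤ (suc j * e) f (suc j * n) (ℕ.*-monoʳ-≤ (suc j) e≤n))
                           (cong f (sym (ℕ.*-distribˡ-∸ (suc j) n e))))
... | no e≰n  = sym (shift-> (suc j * e) f (suc j * n) (ℕ.*-monoʳ-< (suc j) (ℕ.≰⇒> e≰n)))

dissect-oneMinus-⊛ : ∀ j e f → dissect (suc j) (oneMinus (suc j * e) ⊛ f) ≈ oneMinus e ⊛ dissect (suc j) f
dissect-oneMinus-⊛ j e f n =
  trans (oneMinus-⊛-coeff (suc j * e) f (suc j * n))
        (trans (cong (λ x → f (suc j * n) +ᶻ -[1+ 0 ] *ᶻ x) (sym (shift-dissect j e f n)))
               (sym (oneMinus-⊛-coeff e (dissect (suc j) f) n)))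

dissect-qpoch-⊛ : ∀ j K f → dissect (suc j) (qpoch (suc j) (suc j) K ⊛ f) ≈ poch K ⊛ dissect (suc j) f
dissect-qpoch-⊛ j zero    f = ≈-trans (dissect-cong (suc j) (⊛-identityˡ f)) (≈-sym (⊛-identityˡ (dissect (suc j) f)))
dissect-qpoch-⊛ j (suc K) f = begin
  dissect J ((qpoch J J K ⊛ oneMinus (J + J * K)) ⊛ f)     ≈⟨ dissect-cong J (⊛-assoc (qpoch J J K) (oneMinus (J + J * K)) f) ⟩
  dissect J (qpoch J J K ⊛ (oneMinus (J + J * K) ⊛ f))     ≈⟨ dissect-qpoch-⊛ j K (oneMinus (J + J * K) ⊛ f) ⟩
  poch K ⊛ dissect J (oneMinus (J + J * K) ⊛ f)
    ≈⟨ ⊛-congʳ (poch K) (dissect-cong J (⊛-congˡ f (≡⇒≈ (cong oneMinus (exponent j K))))) ⟩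
  poch K ⊛ dissect J (oneMinus (J * (1 + 1 * K)) ⊛ f)      ≈⟨ ⊛-congʳ (poch K) (dissect-oneMinus-⊛ j (1 + 1 * K) f) ⟩
  poch K ⊛ (oneMinus (1 + 1 * K) ⊛ dissect J f)            ≈⟨ ≈-sym (⊛-assoc (poch K) (oneMinus (1 + 1 * K)) (dissect J f)) ⟩
  poch (suc K) ⊛ dissect J f                               ∎
  where
  open SetoidReasoning
  J = suc j
  exponent : ∀ j K → suc j + suc j * K ≡ suc j * (1 + 1 * K)
  exponent = ℕ-Solver.solve-∀

dissect-numerator : ∀ j K s V →
  dissect (suc j) (shift s ((oneMinus (2 * suc j) ⊛ qpoch (suc j) (suc j) K) ⊛ V))
    ≈ (oneMinus 2 ⊛ poch K) ⊛ dissect (suc j) (zpow s ⊛ V)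
dissect-numerator j K s V = begin
  dissect J (shift s ((oneMinus (2 * J) ⊛ Q) ⊛ V))
    ≈⟨ dissect-cong J (≈-trans (≈-sym (zpow-⊛ s ((oneMinus (2 * J) ⊛ Q) ⊛ V))) (regroup (zpow s) (oneMinus (2 * J)) Q V)) ⟩
  dissect J (oneMinus (2 * J) ⊛ (Q ⊛ (zpow s ⊛ V)))
    ≈⟨ dissect-cong J (⊛-congˡ (Q ⊛ (zpow s ⊛ V)) (≡⇒≈ (cong oneMinus (ℕ.*-comm 2 J)))) ⟩
  dissect J (oneMinus (J * 2) ⊛ (Q ⊛ (zpow s ⊛ V)))
    ≈⟨ ≈-trans (dissect-oneMinus-⊛ j 2 (Q ⊛ (zpow s ⊛ V))) (⊛-congʳ (oneMinus 2) (dissect-qpoch-⊛ j K (zpow s ⊛ V))) ⟩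
  oneMinus 2 ⊛ (poch K ⊛ dissect J (zpow s ⊛ V))
    ≈⟨ ≈-sym (⊛-assoc (oneMinus 2) (poch K) (dissect J (zpow s ⊛ V))) ⟩
  (oneMinus 2 ⊛ poch K) ⊛ dissect J (zpow s ⊛ V)
    ∎
  where
  open SetoidReasoning
  J = suc j
  Q = qpoch J J K
  regroup : ∀ z o q v → z ⊛ ((o ⊛ q) ⊛ v) ≈ o ⊛ (q ⊛ (z ⊛ v))
  regroup = solve 4 (λ z o q v → z ⊛′ ((o ⊛′ q) ⊛′ v) ⊜ o ⊛′ (q ⊛′ (z ⊛′ v))) ≈-refl

∣-foldr-lcm : ∀ {x} xs → x ∈ xs → x ∣ List.foldr lcm 1 xs
∣-foldr-lcm (x ∷ xs) (here refl) = m∣lcm[m,n] x _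
∣-foldr-lcm (y ∷ xs) (there x∈xs) = ∣-trans (∣-foldr-lcm xs x∈xs) (n∣lcm[m,n] y _)

suc∣A : ∀ {M k} → k < M → suc k ∣ A M
suc∣A {M} k<M = ∣-foldr-lcm (List.map suc (upTo M)) (∈-map⁺ suc (∈-upTo⁺ k<M))

[n+1]C2≡triangular : ∀ n → (n + 1) C 2 ≡ triangular n
[n+1]C2≡triangular zero    = refl
[n+1]C2≡triangular (suc n) = begin
  (suc n + 1) C 2               ≡⟨ nCk+nC[k+1]≡[n+1]C[k+1] (n + 1) 1 ⟨
  (n + 1) C 1 + (n + 1) C 2     ≡⟨ cong₂ _+_ (nC1≡n (n + 1)) ([n+1]C2≡triangular n) ⟩
  (n + 1) + triangular n        ≡⟨ cong (_+ triangular n) (ℕ.+-comm n 1) ⟩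
  suc n + triangular n          ≡⟨ ℕ.+-comm (suc n) (triangular n) ⟩
  triangular (suc n)            ∎
  where open ≡-Reasoning

2*m≡[m∸j]+[m+j] : ∀ {m j} → j ≤ m → 2 * m ≡ (m ∸ j) + (m + j)
2*m≡[m∸j]+[m+j] {m} {j} j≤m = begin
  2 * m                    ≡⟨ cong (λ x → m + x) (ℕ.+-identityʳ m) ⟩
  m + m                    ≡⟨ cong (λ x → m + x) (ℕ.m∸n+n≡m j≤m) ⟨
  m + ((m ∸ j) + j)        ≡⟨ ℕ.+-comm m ((m ∸ j) + j) ⟩
  ((m ∸ j) + j) + m        ≡⟨ ℕ.+-assoc (m ∸ j) j m ⟩
  (m ∸ j) + (j + m)        ≡⟨ cong (λ x → (m ∸ j) + x) (ℕ.+-comm j m) ⟩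
  (m ∸ j) + (m + j)        ∎
  where open ≡-Reasoning

denominator : ℕ → PS
denominator M = oneMinus 2 ⊛ poch (2 * M ∸ 1)

-- the j-th summand of Num_e(M, r) divided by (1 - z^2)(z;z)_(2M-1), with j = k + 1
dissectedTerm : ℕ → ℕ → ℕ → ℕ → PS
dissectedTerm M a r k =
  sign (M ∸ suc k) · dissect (suc k)
    (zpow (A M * a + (r + (M ∸ suc k + 1) C 2)) ⊛ (invPoch (M ∸ suc k) ⊛ invPoch (M + suc k)))

numTerm≈denominator⊛dissectedTerm : ∀ M a r k → k < M → numTerm M a r k ≈ denominator M ⊛ dissectedTerm M a r k
numTerm≈denominator⊛dissectedTerm M a r k k<M = begin
  sign i · shift t (dissect J (shift s ((Om ⊛ Q) ⊛ invPoch (2 * M) ⊛ gauss (M + J) i)))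
    ≈⟨ ·-cong (sign i) (shift-cong t (dissect-cong J (shift-cong s (≈-trans (⊛-assoc (Om ⊛ Q) (invPoch (2 * M)) (gauss (M + J) i))
                                                                             (⊛-congʳ (Om ⊛ Q) divideGauss))))) ⟩
  sign i · shift t (dissect J (shift s ((Om ⊛ Q) ⊛ V)))
    ≈⟨ ·-cong (sign i) (shift-cong t (dissect-numerator k K s V)) ⟩
  sign i · shift t (denominator M ⊛ dissect J (zpow s ⊛ V))
    ≈⟨ ·-cong (sign i) (≈-trans (shift-⊛ t (denominator M) (dissect J (zpow s ⊛ V)))
                                (⊛-congʳ (denominator M) (shift-dissect k t (zpow s ⊛ V)))) ⟩
  sign i · (denominator M ⊛ dissect J (shift (J * t) (zpow s ⊛ V)))
    ≈⟨ ·-cong (sign i) (⊛-congʳ (denominator M) (dissect-cong J (≈-trans (≈-sym (zpow-⊛ (J * t) (zpow s ⊛ V)))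
         (≈-trans (zpow-⊛-assoc (J * t) s V) (⊛-congˡ V (zpow-cong (cong (_+ s) (m*[n/m]≡n J∣Aa)))))))) ⟩
  sign i · (denominator M ⊛ dissect J (zpow (A M * a + s) ⊛ V))
    ≈⟨ ≈-sym (⊛-·-comm (sign i) (denominator M) (dissect J (zpow (A M * a + s) ⊛ V))) ⟩
  denominator M ⊛ dissectedTerm M a r k
    ∎
  where
  open SetoidReasoning
  J = suc k
  i = M ∸ J
  K = 2 * M ∸ 1
  s = r + (i + 1) C 2
  t = A M * a / J
  Om = oneMinus (2 * J)
  Q = qpoch J J K
  V = invPoch i ⊛ invPoch (M + J)
  J∣Aa : J ∣ A M * a
  J∣Aa = ∣-trans (suc∣A k<M) (m∣m*n a)
  divideGauss : invPoch (2 * M) ⊛ gauss (M + J) i ≈ V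
  divideGauss = begin
    invPoch (2 * M) ⊛ gauss (M + J) i     ≈⟨ ⊛-cong (≡⇒≈ (cong invPoch (2*m≡[m∸j]+[m+j] k<M))) (gauss≈binom (M + J) i) ⟩
    invPoch (i + (M + J)) ⊛ binom i (M + J) ≈⟨ invPoch-⊛-binom i (M + J) ⟩
    V                                      ∎

rhs≈ΣdissectedTerm : ∀ M a r → rhs M a r ≈ ΣPS< M (dissectedTerm M a r)
rhs≈ΣdissectedTerm M a r = begin
  Num M a r ⊛ geomInv 1 ⊛ invPoch K
    ≈⟨ ⊛-congˡ (invPoch K) (⊛-congˡ (geomInv 1) (≈-trans (ΣPS<-cong M (numTerm≈denominator⊛dissectedTerm M a r))
                                                           (≈-sym (⊛-distribˡ-ΣPS< M (denominator M) (dissectedTerm M a r))))) ⟩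
  (oneMinus 2 ⊛ poch K) ⊛ W ⊛ geomInv 1 ⊛ invPoch K
    ≈⟨ regroup (oneMinus 2) (poch K) W (geomInv 1) (invPoch K) ⟩
  W ⊛ ((oneMinus 2 ⊛ geomInv 1) ⊛ (poch K ⊛ invPoch K))
    ≈⟨ ⊛-congʳ W (⊛-cong (oneMinus-⊛-geomInv 1) (poch-⊛-invPoch K)) ⟩
  W ⊛ (onePS ⊛ onePS)
    ≈⟨ ≈-trans (⊛-congʳ W (⊛-identityˡ onePS)) (⊛-identityʳ W) ⟩
  W ∎
  where
  open SetoidReasoning
  K = 2 * M ∸ 1
  W = ΣPS< M (dissectedTerm M a r)
  regroup : ∀ o p w g i → (o ⊛ p) ⊛ w ⊛ g ⊛ i ≈ w ⊛ ((o ⊛ g) ⊛ (p ⊛ i))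
  regroup = solve 5 (λ o p w g i → (((o ⊛′ p) ⊛′ w) ⊛′ g) ⊛′ i ⊜ w ⊛′ ((o ⊛′ g) ⊛′ (p ⊛′ i))) ≈-refl

coeffℤ : PS → ℤ → ℤ
coeffℤ f (+ n)    = f n
coeffℤ f -[1+ _ ] = + 0

coeffℤ-cong : ∀ {f g} → f ≈ g → ∀ z → coeffℤ f z ≡ coeffℤ g z
coeffℤ-cong f≈g (+ n)    = f≈g n
coeffℤ-cong f≈g -[1+ _ ] = refl

coeffℤ-ΣPS< : ∀ n F z → coeffℤ (ΣPS< n F) z ≡ Σ< n (λ i → coeffℤ (F i) z)
coeffℤ-ΣPS< n F (+ k)    = ΣPS<-coeff n F k
coeffℤ-ΣPS< n F -[1+ _ ] = sym (Σ<-zero n (λ _ _ → refl))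

coeffℤ-· : ∀ c f z → coeffℤ (c · f) z ≡ c *ᶻ coeffℤ f z
coeffℤ-· c f (+ n)    = refl
coeffℤ-· c f -[1+ _ ] = sym (ℤ.*-zeroʳ c)

coeffℤ-<-∸ : ∀ f {a b} → a < b → coeffℤ f (+ a -ᶻ + b) ≡ + 0
coeffℤ-<-∸ f {a} {b} a<b rewrite ℤ.m-n≡m⊖n a b | ℤ.⊖-< a<b with b ∸ a | ℕ.m<n⇒0<n∸m a<b
... | suc _ | _ = refl

coeffℤ-≥-∸ : ∀ f {a b} → b ≤ a → coeffℤ f (+ a -ᶻ + b) ≡ f (a ∸ b)
coeffℤ-≥-∸ f {a} {b} b≤a rewrite ℤ.m-n≡m⊖n a b | ℤ.⊖-≥ b≤a = refl

coeffℤ-zpow-⊛ : ∀ e g z → coeffℤ (zpow e ⊛ g) z ≡ coeffℤ g (z -ᶻ + e)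
coeffℤ-zpow-⊛ e g (+ n) with e ≤? n
... | yes e≤n = trans (zpow-⊛ e g n) (trans (shift-≤ e g n e≤n) (sym (coeffℤ-≥-∸ g e≤n)))
... | no e≰n  = trans (zpow-⊛ e g n) (trans (shift-> e g n (ℕ.≰⇒> e≰n)) (sym (coeffℤ-<-∸ g (ℕ.≰⇒> e≰n))))
coeffℤ-zpow-⊛ zero    g -[1+ _ ] = refl
coeffℤ-zpow-⊛ (suc e) g -[1+ _ ] = refl

pℤ≡coeffℤ-gauss : ∀ z m N → + pℤ z m N ≡ coeffℤ (gauss N m) z
pℤ≡coeffℤ-gauss (+ n)    m N = partitionSeries≈gauss m N n
pℤ≡coeffℤ-gauss -[1+ _ ] m N = refl

gaussTerm : ℕ → ℕ → ℤ → ℕ → ℤ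
gaussTerm N m z i = sign i *ᶻ coeffℤ (invPoch i ⊛ invPoch (m ∸ i)) (z -ᶻ + (triangular i + N * i))

coeffℤ-gauss : ∀ N m z → coeffℤ (gauss N m) z ≡ Σ< (suc m) (gaussTerm N m z)
coeffℤ-gauss N m z = begin
  coeffℤ (gauss N m) z
    ≡⟨ coeffℤ-cong (gauss-expansion N m) z ⟩
  coeffℤ (ΣPS< (suc m) (λ i → sign i · (zpow (triangular i + N * i) ⊛ V i))) z
    ≡⟨ coeffℤ-ΣPS< (suc m) _ z ⟩
  Σ< (suc m) (λ i → coeffℤ (sign i · (zpow (triangular i + N * i) ⊛ V i)) z)
    ≡⟨ Σ<-cong (suc m) (λ i _ → trans (coeffℤ-· (sign i) _ z) (cong (sign i *ᶻ_) (coeffℤ-zpow-⊛ _ (V i) z))) ⟩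
  Σ< (suc m) (gaussTerm N m z)
    ∎
  where
  open ≡-Reasoning
  V : ℕ → PS
  V i = invPoch i ⊛ invPoch (m ∸ i)

[x-y]-w≡x-[y+w] : ∀ x y w → + x -ᶻ + y -ᶻ + w ≡ + x -ᶻ + (y + w)
[x-y]-w≡x-[y+w] x y w = trans (reassociate (+ x) (+ y) (+ w)) (cong (+ x -ᶻ_) (sym (ℤ.pos-+ y w)))
  where
  reassociate : ∀ x y w → x -ᶻ y -ᶻ w ≡ x -ᶻ (y +ᶻ w)
  reassociate = ℤ-Solver.solve-∀

[c+x]-[c+y]≡x-y : ∀ c x y → + (c + x) -ᶻ + (c + y) ≡ + x -ᶻ + y
[c+x]-[c+y]≡x-y c x y = trans (ℤ.m-n≡m⊖n (c + x) (c + y)) (trans (ℤ.+-cancelˡ-⊖ c x y) (sym (ℤ.m-n≡m⊖n x y)))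

gaussTerm-vanishes : ∀ m n k l → gaussTerm n (2 * suc m) (+ (suc m * n) -ᶻ + k) (suc m + l) ≡ + 0
gaussTerm-vanishes m n k l =
  trans (cong (λ z → sign (suc m + l) *ᶻ coeffℤ V z) ([x-y]-w≡x-[y+w] (suc m * n) k _))
        (trans (cong (sign (suc m + l) *ᶻ_) (coeffℤ-<-∸ V exponentTooLarge)) (ℤ.*-zeroʳ (sign (suc m + l))))
  where
  V = invPoch (suc m + l) ⊛ invPoch (2 * suc m ∸ (suc m + l))
  expand : ∀ m n k l t → k + ((t + suc (m + l)) + n * (suc m + l)) ≡ suc (suc m * n + (k + t + (m + l) + n * l))
  expand = ℕ-Solver.solve-∀
  exponentTooLarge : suc m * n < k + (triangular (suc m + l) + n * (suc m + l))
  exponentTooLarge = subst (suc m * n <_) (sym (expand m n k l (triangular (m + l)))) (s≤s (ℕ.m≤m+n _ _))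

gaussTerm≡dissectedTerm : ∀ M a r n k → k < M →
  gaussTerm n (2 * M) (+ (M * n) -ᶻ + (A M * a + r)) (M ∸ suc k) ≡ dissectedTerm M a r k n
gaussTerm≡dissectedTerm M a r n k k<M = cong (sign i *ᶻ_) (begin
  coeffℤ (invPoch i ⊛ invPoch (2 * M ∸ i)) (+ (M * n) -ᶻ + (A M * a + r) -ᶻ + (triangular i + n * i))
    ≡⟨ cong₂ coeffℤ (cong (λ x → invPoch i ⊛ invPoch x) 2M∸i≡M+J) exponent ⟩
  coeffℤ V (+ (J * n) -ᶻ + E)
    ≡⟨ coeffℤ-zpow-⊛ E V (+ (J * n)) ⟨
  coeffℤ (zpow E ⊛ V) (+ (J * n))
    ∎)
  where
  open ≡-Reasoning
  J = suc k
  i = M ∸ J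
  E = A M * a + (r + (i + 1) C 2)
  V = invPoch i ⊛ invPoch (M + J)
  2M∸i≡M+J : 2 * M ∸ i ≡ M + J
  2M∸i≡M+J = trans (cong (_∸ i) (2*m≡[m∸j]+[m+j] k<M)) (ℕ.m+n∸m≡n i (M + J))
  regroupₗ : ∀ i j n → (i + j) * n ≡ n * i + j * n
  regroupₗ = ℕ-Solver.solve-∀
  regroupᵣ : ∀ x r t c → (x + r) + (t + c) ≡ c + (x + (r + t))
  regroupᵣ = ℕ-Solver.solve-∀
  exponent : + (M * n) -ᶻ + (A M * a + r) -ᶻ + (triangular i + n * i) ≡ + (J * n) -ᶻ + E
  exponent = begin
    + (M * n) -ᶻ + (A M * a + r) -ᶻ + (triangular i + n * i)
      ≡⟨ [x-y]-w≡x-[y+w] (M * n) (A M * a + r) (triangular i + n * i) ⟩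
    + (M * n) -ᶻ + (A M * a + r + (triangular i + n * i))
      ≡⟨ cong₂ (λ x y → + x -ᶻ + y) (trans (cong (_* n) (sym (ℕ.m∸n+n≡m k<M))) (regroupₗ i J n))
                                     (regroupᵣ (A M * a) r (triangular i) (n * i)) ⟩
    + (n * i + J * n) -ᶻ + (n * i + (A M * a + (r + triangular i)))
      ≡⟨ [c+x]-[c+y]≡x-y (n * i) (J * n) (A M * a + (r + triangular i)) ⟩
    + (J * n) -ᶻ + (A M * a + (r + triangular i))
      ≡⟨ cong (λ t → + (J * n) -ᶻ + (A M * a + (r + t))) ([n+1]C2≡triangular i) ⟨
    + (J * n) -ᶻ + E
      ∎

theorem2p2 : (M a r : ℕ) → NonZero M → (n : ℕ) → lhs M a r n ≡ rhs M a r n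
theorem2p2 zero a r () n
theorem2p2 M@(suc m) a r _ n = begin
  lhs M a r n                                      ≡⟨ pℤ≡coeffℤ-gauss z₀ (2 * M) n ⟩
  coeffℤ (gauss n (2 * M)) z₀                      ≡⟨ coeffℤ-gauss n (2 * M) z₀ ⟩
  Σ< (suc (2 * M)) term                            ≡⟨ cong (λ l → Σ< l term) (2m+1≡m+[m+1] M) ⟩
  Σ< (M + suc M) term                              ≡⟨ Σ<-split M (suc M) term ⟩
  Σ< M term +ᶻ Σ< (suc M) (λ l → term (M + l))     ≡⟨ cong (Σ< M term +ᶻ_) (Σ<-zero (suc M) (λ l _ → gaussTerm-vanishes m n k₀ l)) ⟩
  Σ< M term +ᶻ + 0                                 ≡⟨ ℤ.+-identityʳ (Σ< M term) ⟩
  Σ< M term                                        ≡⟨ Σ<-reverse M term ⟩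
  Σ< M (λ k → term (M ∸ suc k))                    ≡⟨ Σ<-cong M (gaussTerm≡dissectedTerm M a r n) ⟩
  Σ< M (λ k → dissectedTerm M a r k n)             ≡⟨ ΣPS<-coeff M (dissectedTerm M a r) n ⟨
  ΣPS< M (dissectedTerm M a r) n                   ≡⟨ rhs≈ΣdissectedTerm M a r n ⟨
  rhs M a r n                                      ∎
  where
  open ≡-Reasoning
  k₀ = A M * a + r
  z₀ = + (M * n) -ᶻ + k₀
  term = gaussTerm n (2 * M) z₀
  2m+1≡m+[m+1] : ∀ m → suc (2 * m) ≡ m + suc m
  2m+1≡m+[m+1] = ℕ-Solver.solve-∀
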